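{- Let $p>n$ be prime and let $M$ be an oracle machine computing a polynomial $H:\mathbb{Z}_p^{n^2}\to\mathbb{Z}_p$ with $H\in\mathbb{V}_{n,p}$. Consider the test that samples $E\leftarrow_r\mathbb{Z}_p^{n^2}$ and $\pi\leftarrow_r S_n$ uniformly and independently, queries $M$ on $E$ and on $\pi(E)$, and accepts iff the two answers are equal. Then: (1) if $H\in\mathbb{I}_{n,p}$, the test accepts with probability $1$; (2) if $H\notin\mathbb{I}_{n,p}$, the test accepts with probability at most $1/2+n/p$.
   Context: For $E=(e_{(i,j)})_{(i,j)\in[n]^2}$ and $\pi\in S_n$, $\pi(E)=(e_{(\pi(i),\pi(j))})_{(i,j)\in[n]^2}$. $\mathbb{V}_{n,p}$ (generalized permanents) is the set of polynomials of the form $E\mapsto\sum_{\sigma\in S_n}a_\sigma\prod_{i\in[n]}e_{(i,\sigma(i))}$ with $a_\sigma\in\mathbb{Z}_p$. For $H\in\mathbb{V}_{n,p}$, $\Pi(H)=\{\pi\in S_n: H(\pi(E))\text{ and }H(E)\text{ are the same formal polynomial}\}$, a subgroup of $S_n$; $\mathbb{I}_{n,p}=\{H\in\mathbb{V}_{n,p}:\Pi(H)=S_n\}$. -}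

module Defs where

open import Data.Nat using (ℕ; zero; suc; _+_; _*_; _%_)
import Data.Nat.Properties as ℕP
open import Data.Fin using (Fin; toℕ)
import Data.Fin.Properties as FinP
open import Data.Vec using (Vec; []; _∷_; lookup; tabulate)
open import Data.Nat.ListAction using (sum; product)
open import Data.List using (List; []; _∷_; map; concatMap; allFin; filter; length; cartesianProduct)
open import Data.Product using (_×_; _,_; proj₁; proj₂)
open import Relation.Nullary using (Dec; yes; no)
open import Relation.Nullary.Decidable using (_→-dec_)
open import Relation.Binary.PropositionalEquality using (_≡_)

-- Reduction mod p (Z_p is represented by {0,…,p-1} ⊆ ℕ; p will be prime, so p ≠ 0).
modp : ℕ → ℕ → ℕ
modp zero    x = x
modp (suc q) x = x % suc q

allVecs : {A : Set} → (k : ℕ) → List A → List (Vec A k)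
allVecs zero    xs = [] ∷ []
allVecs (suc k) xs = concatMap (λ x → map (x ∷_) (allVecs k xs)) xs

-- A permutation of [n] is represented by the vector (σ(0),…,σ(n-1)); it is a
-- permutation iff injective (equivalently bijective on Fin n).
IsPerm : {n : ℕ} → Vec (Fin n) n → Set
IsPerm {n} σ = (i j : Fin n) → lookup σ i ≡ lookup σ j → i ≡ j

isPerm? : {n : ℕ} → (σ : Vec (Fin n) n) → Dec (IsPerm σ)
isPerm? {n} σ = FinP.all? λ i → FinP.all? λ j → (lookup σ i FinP.≟ lookup σ j) →-dec (i FinP.≟ j)

Sn : (n : ℕ) → List (Vec (Fin n) n)
Sn n = filter isPerm? (allVecs n (allFin n))

-- Inputs E ∈ Z_p^{n²}: E = (e_(i,j)), row i is lookup E i.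
Mat : ℕ → ℕ → Set
Mat n p = Vec (Vec (Fin p) n) n

entry : {n p : ℕ} → Mat n p → Fin n → Fin n → ℕ
entry E i j = toℕ (lookup (lookup E i) j)

allMats : (n p : ℕ) → List (Mat n p)
allMats n p = allVecs n (allVecs n (allFin p))

actMat : {n p : ℕ} → Vec (Fin n) n → Mat n p → Mat n p
actMat π E = tabulate λ i → tabulate λ j → lookup (lookup E (lookup π i)) (lookup π j)

-- A generalized permanent H ∈ V_{n,p} is given by its coefficients a_σ ∈ Z_p
-- (only the values at permutations σ are used).
Coeffs : ℕ → ℕ → Set
Coeffs n p = Vec (Fin n) n → Fin p

evalH : {n : ℕ} (p : ℕ) → Coeffs n p → Mat n p → ℕ
evalH {n} p a E =
  modp p (sum (map (λ σ → toℕ (a σ) * product (map (λ i → entry E i (lookup σ i)) (allFin n))) (Sn n)))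

-- Formal polynomials in the n² variables e_(i,j) over Z_p: coefficient functions
-- on exponent vectors (a monomial ∏ e_(i,j)^{m i j} is given by m).
Exponent : ℕ → Set
Exponent n = Fin n → Fin n → ℕ

Poly : ℕ → Set
Poly n = Exponent n → ℕ

SamePoly : {n : ℕ} → ℕ → Poly n → Poly n → Set
SamePoly p P Q = ∀ m → modp p (P m) ≡ modp p (Q m)

-- The exponent vector of the monomial ∏_i e_(i,σ(i)).
indic : {n : ℕ} → Vec (Fin n) n → Fin n → Fin n → ℕ
indic σ i j with lookup σ i FinP.≟ j
... | yes _ = 1
... | no  _ = 0

isMonoOf? : {n : ℕ} → (σ : Vec (Fin n) n) → (m : Exponent n) → Dec (∀ i j → m i j ≡ indic σ i j)
isMonoOf? σ m = FinP.all? λ i → FinP.all? λ j → m i j ℕP.≟ indic σ i j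

toPoly : {n p : ℕ} → Coeffs n p → Poly n
toPoly {n} a m = sum (map (λ σ → term σ (isMonoOf? σ m)) (Sn n))
  where
  term : ∀ σ → Dec (∀ i j → m i j ≡ indic σ i j) → ℕ
  term σ (yes _) = toℕ (a σ)
  term σ (no  _) = 0

-- The formal polynomial P(π(E)), i.e. P after the substitution e_(i,j) ↦ e_(π(i),π(j)):
-- the monomial with exponents m becomes the one with exponents m' where m'(π i, π j) = m(i,j).
renameVars : {n : ℕ} → Vec (Fin n) n → Poly n → Poly n
renameVars π P m' = P (λ i j → m' (lookup π i) (lookup π j))

InPi : {n : ℕ} (p : ℕ) → Coeffs n p → Vec (Fin n) n → Set
InPi p a π = SamePoly p (renameVars π (toPoly a)) (toPoly a)

InI : (n p : ℕ) → Coeffs n p → Set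
InI n p a = (π : Vec (Fin n) n) → IsPerm π → InPi p a π

-- The test: sample (E, π) uniformly from Z_p^{n²} × S_n, accept iff M(E) = M(π(E)),
-- where the oracle machine M returns H's values.
accepts? : {n p : ℕ} (a : Coeffs n p) → (x : Mat n p × Vec (Fin n) n) →
           Dec (evalH p a (proj₁ x) ≡ evalH p a (actMat (proj₂ x) (proj₁ x)))
accepts? {n} {p} a (E , π) = evalH p a E ℕP.≟ evalH p a (actMat π E)

acceptCount : (n p : ℕ) → Coeffs n p → ℕ
acceptCount n p a = length (filter (accepts? a) (cartesianProduct (allMats n p) (Sn n)))

sampleCount : (n p : ℕ) → ℕ
sampleCount n p = length (allMats n p) * length (Sn n)

{-# OPTIONS --safe #-}
module Submission where

-- Both H(E) and H(π(E)) are generalized permanents in E: the coefficient of ∏ᵢ e_(i,τ(i)) in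
-- H(π(E)) is a_σ for τ = πσπ⁻¹. If π ∈ Π(H) these coefficient families agree mod p and the
-- test accepts for every E. Otherwise H(E) − H(π(E)) is a nonzero polynomial that is linear
-- in each of the n rows of E, so expanding row by row (Schwartz–Zippel) it vanishes on at
-- most a fraction n/p of the E. Finally, σ ∈ Π(H) and πσ ∈ Π(H) force π ∈ Π(H); so if some
-- π ∉ Π(H), then σ ↦ πσ maps Π(H) injectively into its complement and |Π(H)| ≤ |S_n|/2.
-- Averaging over π bounds the acceptance probability by 1/2 + n/p.

open import Defs
open import Data.Nat using (ℕ; zero; suc; _+_; _*_; _∸_; _^_; _≤_; _<_; _%_; z≤n; s≤s; NonZero; pred; >-nonZero⁻¹)
open import Data.Nat.Properties
open import Data.Nat.DivMod using (%-distribˡ-+; %-distribˡ-*; [m+kn]%n≡m%n; m<n⇒m%n≡m; %-remove-+ʳ)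
open import Data.Nat.Divisibility using (_∣_; ∣⇒≤; m%n≡0⇒n∣m)
open import Data.Nat.Primality using (Prime; euclidsLemma; prime⇒nonZero)
open import Data.Nat.ListAction using (sum; product)
open import Data.Nat.ListAction.Properties using (sum-++; product-↭)
open import Data.Nat.Tactic.RingSolver using (solve-∀)
open import Algebra.Properties.CommutativeSemigroup +-commutativeSemigroup using (interchange) renaming (xy∙z≈xz∙y to +-right-comm)
open import Algebra.Properties.CommutativeSemigroup *-commutativeSemigroup using () renaming (x∙yz≈y∙xz to *-left-comm)
open import Data.Fin using (Fin; zero; suc; toℕ; punchOut)
import Data.Fin.Properties as Fin
open import Data.Vec using (Vec; []; _∷_; lookup; tabulate)
import Data.Vec.Properties as Vec
open import Data.List using (List; []; _∷_; _++_; map; filter; length; concatMap; cartesianProductWith; cartesianProduct; allFin)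
open import Data.List.Properties using (map-++; map-∘; map-cong; map-tabulate; length-map; length-tabulate; filter-notAll)
open import Data.List.Membership.Propositional using (_∈_; _∉_; find)
open import Data.List.Membership.Propositional.Properties using (∈-map⁺; ∈-map⁻; ∈-allFin; ∈-filter⁺; ∈-filter⁻; ∈-cartesianProductWith⁺)
open import Data.List.Membership.Propositional.Properties.WithK using (unique∧set⇒bag)
open import Data.List.Relation.Unary.Any using (here; there; any?; satisfied)
import Data.List.Relation.Unary.Any as Any
open import Data.List.Relation.Unary.All using (All; [])
import Data.List.Relation.Unary.All as All
open import Data.List.Relation.Unary.All.Properties using (¬All⇒Any¬)
open import Data.List.Relation.Unary.AllPairs using ([]; _∷_)
open import Data.List.Relation.Unary.Unique.Propositional using (Unique)
import Data.List.Relation.Unary.Unique.Propositional.Properties as Unique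
open import Data.List.Relation.Binary.BagAndSetEquality using (∼bag⇒↭)
import Data.List.Relation.Binary.Permutation.Propositional.Properties as ↭
open import Data.Product using (_×_; _,_; proj₂)
open import Data.Sum using (inj₁; inj₂)
open import Data.Empty using (⊥-elim)
open import Function using (_∘_; id)
open import Function.Bundles using (mk⇔)
open import Relation.Nullary using (Dec; yes; no; ¬_; ¬?)
open import Relation.Unary using (Decidable)
open import Relation.Binary.Bundles using (Setoid)
open import Relation.Binary.Definitions using (DecidableEquality)
import Relation.Binary.Reasoning.Setoid as SetoidReasoning
open import Level using (0ℓ)
open import Relation.Binary.PropositionalEquality

-- Finite sums and counting

∑ : {A : Set} → List A → (A → ℕ) → ℕ
∑ xs f = sum (map f xs)

when : {P : Set} → Dec P → ℕ → ℕ
when (yes _) x = x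
when (no  _) _ = 0

𝟙 : {P : Set} → Dec P → ℕ
𝟙 d = when d 1

module _ {P : Set} where

  when-cong : {Q : Set} → (P → Q) → (Q → P) → (d : Dec P) (e : Dec Q) (x : ℕ) →
              when d x ≡ when e x
  when-cong _   _   (yes _) (yes _) _ = refl
  when-cong P⇒Q _   (yes p) (no ¬q) _ = ⊥-elim (¬q (P⇒Q p))
  when-cong _   Q⇒P (no ¬p) (yes q) _ = ⊥-elim (¬p (Q⇒P q))
  when-cong _   _   (no _)  (no _)  _ = refl

  when-yes : P → (d : Dec P) (x : ℕ) → when d x ≡ x
  when-yes _ (yes _) _ = refl
  when-yes p (no ¬p) _ = ⊥-elim (¬p p)

  when-no : ¬ P → (d : Dec P) (x : ℕ) → when d x ≡ 0
  when-no ¬p (yes p) _ = ⊥-elim (¬p p)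
  when-no _  (no _)  _ = refl

  when-*ʳ : (d : Dec P) (x y : ℕ) → when d x * y ≡ when d (x * y)
  when-*ʳ (yes _) _ _ = refl
  when-*ʳ (no _)  _ _ = refl

  𝟙≤1 : (d : Dec P) → 𝟙 d ≤ 1
  𝟙≤1 (yes _) = s≤s z≤n
  𝟙≤1 (no _)  = z≤n

  𝟙+𝟙¬≡1 : (d : Dec P) → 𝟙 d + 𝟙 (¬? d) ≡ 1
  𝟙+𝟙¬≡1 (yes _) = refl
  𝟙+𝟙¬≡1 (no _)  = refl

module _ {A : Set} where

  ∑-++ : (xs ys : List A) (f : A → ℕ) → ∑ (xs ++ ys) f ≡ ∑ xs f + ∑ ys f
  ∑-++ xs ys f = trans (cong sum (map-++ f xs ys)) (sum-++ (map f xs) (map f ys))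

  ∑-cong : (xs : List A) {f g : A → ℕ} → (∀ {x} → x ∈ xs → f x ≡ g x) → ∑ xs f ≡ ∑ xs g
  ∑-cong []       _    = refl
  ∑-cong (x ∷ xs) f≡g = cong₂ _+_ (f≡g (here refl)) (∑-cong xs (f≡g ∘ there))

  ∑-mono-≤ : (xs : List A) {f g : A → ℕ} → (∀ {x} → x ∈ xs → f x ≤ g x) → ∑ xs f ≤ ∑ xs g
  ∑-mono-≤ []       _    = z≤n
  ∑-mono-≤ (x ∷ xs) f≤g = +-mono-≤ (f≤g (here refl)) (∑-mono-≤ xs (f≤g ∘ there))

  ∑-distrib-+ : (xs : List A) (f g : A → ℕ) → ∑ xs (λ x → f x + g x) ≡ ∑ xs f + ∑ xs g
  ∑-distrib-+ []       f g = refl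
  ∑-distrib-+ (x ∷ xs) f g =
    trans (cong (f x + g x +_) (∑-distrib-+ xs f g)) (interchange (f x) (g x) (∑ xs f) (∑ xs g))

  *-distribˡ-∑ : (c : ℕ) (xs : List A) (f : A → ℕ) → c * ∑ xs f ≡ ∑ xs (λ x → c * f x)
  *-distribˡ-∑ c []       f = *-zeroʳ c
  *-distribˡ-∑ c (x ∷ xs) f =
    trans (*-distribˡ-+ c (f x) (∑ xs f)) (cong (c * f x +_) (*-distribˡ-∑ c xs f))

  *-distribʳ-∑ : (c : ℕ) (xs : List A) (f : A → ℕ) → ∑ xs f * c ≡ ∑ xs (λ x → f x * c)
  *-distribʳ-∑ c xs f = trans (*-comm (∑ xs f) c)
    (trans (*-distribˡ-∑ c xs f) (∑-cong xs (λ {x} _ → *-comm c (f x))))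

  ∑-const : (xs : List A) (c : ℕ) → ∑ xs (λ _ → c) ≡ length xs * c
  ∑-const []       c = refl
  ∑-const (x ∷ xs) c = cong (c +_) (∑-const xs c)

  ∑0≡0 : (xs : List A) → ∑ xs (λ _ → 0) ≡ 0
  ∑0≡0 xs = trans (∑-const xs 0) (*-zeroʳ (length xs))

  length≡∑1 : (xs : List A) → length xs ≡ ∑ xs (λ _ → 1)
  length≡∑1 xs = trans (sym (*-identityʳ (length xs))) (sym (∑-const xs 1))

  count : {P : A → Set} → Decidable P → List A → ℕ
  count P? xs = ∑ xs (λ x → 𝟙 (P? x))

  module _ {P : A → Set} (P? : Decidable P) where

    ∑-filter : (xs : List A) (f : A → ℕ) → ∑ (filter P? xs) f ≡ ∑ xs (λ x → when (P? x) (f x))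
    ∑-filter []       f = refl
    ∑-filter (x ∷ xs) f with P? x
    ... | yes _ = cong (f x +_) (∑-filter xs f)
    ... | no  _ = ∑-filter xs f

    length-filter≡count : (xs : List A) → length (filter P? xs) ≡ count P? xs
    length-filter≡count xs = trans (length≡∑1 (filter P? xs)) (∑-filter xs (λ _ → 1))

    count≤length : (xs : List A) → count P? xs ≤ length xs
    count≤length xs =
      ≤-trans (∑-mono-≤ xs (λ {x} _ → 𝟙≤1 (P? x))) (≤-reflexive (sym (length≡∑1 xs)))

    count≤1 : (xs : List A) → Unique xs → (∀ {x y} → P x → P y → x ≡ y) → count P? xs ≤ 1
    count≤1 []       _        _      = z≤n
    count≤1 (x ∷ xs) (x∉ ∷ u) unique with P? x
    ... | no  _  = count≤1 xs u unique
    ... | yes px = ≤-reflexive (cong suc (trans (∑-cong xs others-fail) (∑0≡0 xs)))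
      where
      others-fail : ∀ {y} → y ∈ xs → 𝟙 (P? y) ≡ 0
      others-fail y∈xs = when-no (λ py → All.lookup x∉ y∈xs (unique px py)) (P? _) 1

∑-map : {A B : Set} (g : A → B) (xs : List A) (f : B → ℕ) → ∑ (map g xs) f ≡ ∑ xs (λ x → f (g x))
∑-map g xs f = cong sum (sym (map-∘ xs))

module _ {A B : Set} where

  ∑-cartesianProductWith : {C : Set} (g : A → B → C) (xs : List A) (ys : List B) (f : C → ℕ) →
    ∑ (cartesianProductWith g xs ys) f ≡ ∑ xs (λ x → ∑ ys (λ y → f (g x y)))
  ∑-cartesianProductWith g []       ys f = refl
  ∑-cartesianProductWith g (x ∷ xs) ys f = trans (∑-++ (map (g x) ys) _ f)
    (cong₂ _+_ (∑-map (g x) ys f) (∑-cartesianProductWith g xs ys f))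

  ∑-comm : (xs : List A) (ys : List B) (f : A → B → ℕ) →
    ∑ xs (λ x → ∑ ys (f x)) ≡ ∑ ys (λ y → ∑ xs (λ x → f x y))
  ∑-comm []       ys f = sym (∑0≡0 ys)
  ∑-comm (x ∷ xs) ys f =
    trans (cong (∑ ys (f x) +_) (∑-comm xs ys f)) (sym (∑-distrib-+ ys (f x) _))

module _ {A : Set} (_≟_ : DecidableEquality A) where

  ∑-when-∉ : (xs : List A) (y : A) (g : A → ℕ) → y ∉ xs → ∑ xs (λ x → when (y ≟ x) (g x)) ≡ 0
  ∑-when-∉ []       y g _   = refl
  ∑-when-∉ (x ∷ xs) y g y∉ with y ≟ x
  ... | yes refl = ⊥-elim (y∉ (here refl))
  ... | no  _    = ∑-when-∉ xs y g (λ y∈ → y∉ (there y∈))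

  ∑-when-≡ : (xs : List A) (y : A) (g : A → ℕ) → Unique xs → y ∈ xs →
             ∑ xs (λ x → when (y ≟ x) (g x)) ≡ g y
  ∑-when-≡ (x ∷ xs) y g u y∈ with y ≟ x
  ∑-when-≡ (x ∷ xs) y g u       _          | yes refl =
    trans (cong (g x +_) (∑-when-∉ xs x g (Unique.Unique[x∷xs]⇒x∉xs u))) (+-identityʳ (g x))
  ∑-when-≡ (x ∷ xs) y g _       (here y≡x) | no y≢x = ⊥-elim (y≢x y≡x)
  ∑-when-≡ (x ∷ xs) y g (_ ∷ u) (there y∈) | no _   = ∑-when-≡ xs y g u y∈

  ∑-fibres : {B : Set} (g : B → A) (xs : List B) (ys : List A) → Unique ys → (∀ x → g x ∈ ys) →
             (w : B → ℕ) (h : A → ℕ) →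
             ∑ xs (λ x → w x * h (g x)) ≡ ∑ ys (λ y → ∑ xs (λ x → when (g x ≟ y) (w x)) * h y)
  ∑-fibres g xs ys u g∈ys w h = begin
    ∑ xs (λ x → w x * h (g x))
      ≡⟨ ∑-cong xs (λ {x} _ → sym (∑-when-≡ ys (g x) (λ y → w x * h y) u (g∈ys x))) ⟩
    ∑ xs (λ x → ∑ ys (λ y → when (g x ≟ y) (w x * h y)))
      ≡⟨ ∑-cong xs (λ {x} _ → ∑-cong ys (λ {y} _ → sym (when-*ʳ (g x ≟ y) (w x) (h y)))) ⟩
    ∑ xs (λ x → ∑ ys (λ y → when (g x ≟ y) (w x) * h y))
      ≡⟨ ∑-comm xs ys _ ⟩
    ∑ ys (λ y → ∑ xs (λ x → when (g x ≟ y) (w x) * h y))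
      ≡⟨ ∑-cong ys (λ {y} _ → sym (*-distribʳ-∑ (h y) xs _)) ⟩
    ∑ ys (λ y → ∑ xs (λ x → when (g x ≟ y) (w x)) * h y) ∎
    where open ≡-Reasoning

-- Enumerations

module _ {A : Set} (_≟_ : DecidableEquality A) where

  Unique∧⊆⇒length≤ : {xs ys : List A} → Unique xs → (∀ {x} → x ∈ xs → x ∈ ys) →
                     length xs ≤ length ys
  Unique∧⊆⇒length≤ {[]}     _         _    = z≤n
  Unique∧⊆⇒length≤ {x ∷ xs} {ys} (x∉ ∷ u) xs⊆ys =
    ≤-trans (s≤s (Unique∧⊆⇒length≤ u xs⊆ys-x))
            (filter-notAll ≢x? ys (Any.map (λ y≡x y≢x → y≢x (sym y≡x)) (xs⊆ys (here refl))))
    where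
    ≢x? = λ y → ¬? (y ≟ x)
    xs⊆ys-x : ∀ {y} → y ∈ xs → y ∈ filter ≢x? ys
    xs⊆ys-x y∈xs = ∈-filter⁺ ≢x? (xs⊆ys (there y∈xs)) (λ y≡x → All.lookup x∉ y∈xs (sym y≡x))

map-allFin-suc : {A : Set} (k : ℕ) (f : Fin (suc k) → A) →
                 map f (allFin (suc k)) ≡ f zero ∷ map (λ i → f (suc i)) (allFin k)
map-allFin-suc k f =
  cong (f zero ∷_) (trans (map-tabulate suc f) (sym (map-tabulate id (λ i → f (suc i)))))

length-allFin : (k : ℕ) → length (allFin k) ≡ k
length-allFin k = length-tabulate id

module _ {A : Set} where

  concatMap-map≡cartesianProductWith : {B C : Set} (g : A → B → C) (xs : List A) (ys : List B) →
    concatMap (λ x → map (g x) ys) xs ≡ cartesianProductWith g xs ys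
  concatMap-map≡cartesianProductWith g []       ys = refl
  concatMap-map≡cartesianProductWith g (x ∷ xs) ys =
    cong (map (g x) ys ++_) (concatMap-map≡cartesianProductWith g xs ys)

  allVecs-suc : (k : ℕ) (xs : List A) → allVecs (suc k) xs ≡ cartesianProductWith _∷_ xs (allVecs k xs)
  allVecs-suc k xs = concatMap-map≡cartesianProductWith _∷_ xs (allVecs k xs)

  ∑-allVecs-suc : (k : ℕ) (xs : List A) (f : Vec A (suc k) → ℕ) →
    ∑ (allVecs (suc k) xs) f ≡ ∑ xs (λ x → ∑ (allVecs k xs) (λ v → f (x ∷ v)))
  ∑-allVecs-suc k xs f = trans (cong (λ vs → ∑ vs f) (allVecs-suc k xs))
                               (∑-cartesianProductWith _∷_ xs (allVecs k xs) f)

  length-allVecs : (k : ℕ) (xs : List A) → length (allVecs k xs) ≡ length xs ^ k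
  length-allVecs zero    xs = refl
  length-allVecs (suc k) xs = begin
    length (allVecs (suc k) xs)               ≡⟨ length≡∑1 (allVecs (suc k) xs) ⟩
    ∑ (allVecs (suc k) xs) (λ _ → 1)          ≡⟨ ∑-allVecs-suc k xs (λ _ → 1) ⟩
    ∑ xs (λ _ → ∑ (allVecs k xs) (λ _ → 1))   ≡⟨ ∑-const xs _ ⟩
    length xs * ∑ (allVecs k xs) (λ _ → 1)    ≡⟨ cong (length xs *_) (length≡∑1 (allVecs k xs)) ⟨
    length xs * length (allVecs k xs)         ≡⟨ cong (length xs *_) (length-allVecs k xs) ⟩
    length xs ^ suc k                         ∎
    where open ≡-Reasoning

  ∈-allVecs : (k : ℕ) (xs : List A) (v : Vec A k) → (∀ i → lookup v i ∈ xs) → v ∈ allVecs k xs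
  ∈-allVecs zero    xs []      _        = here refl
  ∈-allVecs (suc k) xs (x ∷ v) entries∈ = subst (x ∷ v ∈_) (sym (allVecs-suc k xs))
    (∈-cartesianProductWith⁺ _∷_ (entries∈ zero) (∈-allVecs k xs v (entries∈ ∘ suc)))

  allVecs-unique : (k : ℕ) (xs : List A) → Unique xs → Unique (allVecs k xs)
  allVecs-unique zero    xs _ = [] ∷ []
  allVecs-unique (suc k) xs u = subst Unique (sym (allVecs-suc k xs))
    (Unique.cartesianProductWith⁺ _∷_ Vec.∷-injective u (allVecs-unique k xs u))

-- Congruence modulo p

modp≡% : (p : ℕ) .{{_ : NonZero p}} (x : ℕ) → modp p x ≡ x % p
modp≡% (suc q) x = refl

module Congruence (p : ℕ) .{{_ : NonZero p}} where

  infix 4 _≈_ _≈?_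

  record _≈_ (x y : ℕ) : Set where
    constructor mod
    field %≡% : x % p ≡ y % p

  open _≈_ public

  _≈?_ : (x y : ℕ) → Dec (x ≈ y)
  x ≈? y with x % p ≟ y % p
  ... | yes x≈y = yes (mod x≈y)
  ... | no  x≉y = no (λ x≈y → x≉y (%≡% x≈y))

  ≈-reflexive : ∀ {x y} → x ≡ y → x ≈ y
  ≈-reflexive refl = mod refl

  ≈-refl : ∀ {x} → x ≈ x
  ≈-refl = mod refl

  ≈-sym : ∀ {x y} → x ≈ y → y ≈ x
  ≈-sym (mod e) = mod (sym e)

  ≈-trans : ∀ {x y z} → x ≈ y → y ≈ z → x ≈ z
  ≈-trans (mod e) (mod e′) = mod (trans e e′)

  +-cong-≈ : ∀ {a b c d} → a ≈ b → c ≈ d → a + c ≈ b + d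
  +-cong-≈ {a} {b} {c} {d} (mod a≈b) (mod c≈d) = mod (begin
    (a + c) % p           ≡⟨ %-distribˡ-+ a c p ⟩
    (a % p + c % p) % p   ≡⟨ cong₂ (λ u v → (u + v) % p) a≈b c≈d ⟩
    (b % p + d % p) % p   ≡⟨ %-distribˡ-+ b d p ⟨
    (b + d) % p           ∎)
    where open ≡-Reasoning

  *-cong-≈ : ∀ {a b c d} → a ≈ b → c ≈ d → a * c ≈ b * d
  *-cong-≈ {a} {b} {c} {d} (mod a≈b) (mod c≈d) = mod (begin
    (a * c) % p             ≡⟨ %-distribˡ-* a c p ⟩
    (a % p * (c % p)) % p   ≡⟨ cong₂ (λ u v → (u * v) % p) a≈b c≈d ⟩
    (b % p * (d % p)) % p   ≡⟨ %-distribˡ-* b d p ⟨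
    (b * d) % p             ∎)
    where open ≡-Reasoning

  ∑-cong-≈ : {A : Set} (xs : List A) {f g : A → ℕ} → (∀ x → f x ≈ g x) → ∑ xs f ≈ ∑ xs g
  ∑-cong-≈ []       _    = ≈-refl
  ∑-cong-≈ (x ∷ xs) f≈g = +-cong-≈ (f≈g x) (∑-cong-≈ xs f≈g)

  ≈-setoid : Setoid 0ℓ 0ℓ
  ≈-setoid = record
    { Carrier       = ℕ
    ; _≈_           = _≈_
    ; isEquivalence = record { refl = ≈-refl ; sym = ≈-sym ; trans = ≈-trans }
    }

  module ≈-Reasoning = SetoidReasoning ≈-setoid

  -- Adding k * p changes nothing, and k * p = k + k * pred p.
  +-cancelʳ-≈ : ∀ {a b} k → a + k ≈ b + k → a ≈ b
  +-cancelʳ-≈ {a} {b} k a+k≈b+k = begin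
    a                    ≈⟨ +kp a ⟨
    a + k * p            ≡⟨ regroup a ⟩
    a + k + k * pred p   ≈⟨ +-cong-≈ a+k≈b+k ≈-refl ⟩
    b + k + k * pred p   ≡⟨ regroup b ⟨
    b + k * p            ≈⟨ +kp b ⟩
    b                    ∎
    where
    open ≈-Reasoning
    +kp : ∀ x → x + k * p ≈ x
    +kp x = mod ([m+kn]%n≡m%n x k p)
    regroup : ∀ x → x + k * p ≡ x + k + k * pred p
    regroup x = trans (cong (λ q → x + k * q) (sym (suc-pred p)))
                      (trans (cong (x +_) (*-suc k (pred p))) (sym (+-assoc x k (k * pred p))))

  +-cancelˡ-≈ : ∀ {a b} k → k + a ≈ k + b → a ≈ b
  +-cancelˡ-≈ {a} {b} k k+a≈k+b = +-cancelʳ-≈ k (begin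
    a + k   ≡⟨ +-comm a k ⟩
    k + a   ≈⟨ k+a≈k+b ⟩
    k + b   ≡⟨ +-comm k b ⟩
    b + k   ∎)
    where open ≈-Reasoning

  ≈0⇒∣ : ∀ {x} → x ≈ 0 → p ∣ x
  ≈0⇒∣ {x} (mod x≈0) = m%n≡0⇒n∣m x p (trans x≈0 (m<n⇒m%n≡m (>-nonZero⁻¹ p)))

  ∣⇒+≈ : ∀ d {s} → p ∣ s → d + s ≈ d
  ∣⇒+≈ d p∣s = mod (%-remove-+ʳ d p∣s)

  *[+]≈*⇒*≈0 : ∀ t d s → t * (d + s) ≈ t * d → t * s ≈ 0
  *[+]≈*⇒*≈0 t d s t[d+s]≈td = +-cancelˡ-≈ (t * d) (begin
    t * d + t * s   ≡⟨ *-distribˡ-+ t d s ⟨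
    t * (d + s)     ≈⟨ t[d+s]≈td ⟩
    t * d           ≡⟨ +-identityʳ (t * d) ⟨
    t * d + 0       ∎)
    where open ≈-Reasoning

  ∣∧<⇒≡0 : ∀ {t} → p ∣ t → t < p → t ≡ 0
  ∣∧<⇒≡0 {zero}  _   _   = refl
  ∣∧<⇒≡0 {suc t} p∣t t<p = ⊥-elim (<⇒≱ t<p (∣⇒≤ p∣t))

  module _ (p-prime : Prime p) where

    private
      *-cancel-+ : ∀ {t d} s → t < p → ¬ (d + s ≈ d) → t * (d + s) ≈ t * d → t ≡ 0
      *-cancel-+ {t} {d} s t<p d+s≉d t[d+s]≈td with euclidsLemma t s p-prime (≈0⇒∣ (*[+]≈*⇒*≈0 t d s t[d+s]≈td))
      ... | inj₁ p∣t = ∣∧<⇒≡0 p∣t t<p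
      ... | inj₂ p∣s = ⊥-elim (d+s≉d (∣⇒+≈ d p∣s))

    *-cancelˡ-≈ : ∀ {t c d} → t < p → ¬ (c ≈ d) → t * c ≈ t * d → t ≡ 0
    *-cancelˡ-≈ {t} {c} {d} t<p c≉d tc≈td with ≤-total d c
    ... | inj₁ d≤c = *-cancel-+ (c ∸ d) t<p (λ e → c≉d (subst (_≈ d) (m+[n∸m]≡n d≤c) e))
                       (subst (λ x → t * x ≈ t * d) (sym (m+[n∸m]≡n d≤c)) tc≈td)
    ... | inj₂ c≤d = *-cancel-+ (d ∸ c) t<p (λ e → c≉d (≈-sym (subst (_≈ c) (m+[n∸m]≡n c≤d) e)))
                       (subst (λ x → t * x ≈ t * c) (sym (m+[n∸m]≡n c≤d)) (≈-sym tc≈td))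

    private
      affine-root-unique-≤ : ∀ {A B c d x y} → ¬ (c ≈ d) → x ≤ y → y < p →
        A + x * c ≈ B + x * d → A + y * c ≈ B + y * d → x ≡ y
      affine-root-unique-≤ {A} {B} {c} {d} {x} {y} c≉d x≤y y<p x-root y-root =
        trans (sym (+-identityʳ x)) (trans (cong (x +_) (sym t≡0)) (m+[n∸m]≡n x≤y))
        where
        t = y ∸ x
        shift : ∀ A c → A + y * c ≡ (A + x * c) + t * c
        shift A c = begin
          A + y * c              ≡⟨ cong (λ z → A + z * c) (m+[n∸m]≡n x≤y) ⟨
          A + (x + t) * c        ≡⟨ cong (A +_) (*-distribʳ-+ c x t) ⟩
          A + (x * c + t * c)    ≡⟨ +-assoc A (x * c) (t * c) ⟨
          A + x * c + t * c      ∎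
          where open ≡-Reasoning
        tc≈td : t * c ≈ t * d
        tc≈td = +-cancelʳ-≈ (A + x * c) (begin
          t * c + (A + x * c)   ≡⟨ +-comm (t * c) _ ⟩
          A + x * c + t * c     ≡⟨ shift A c ⟨
          A + y * c             ≈⟨ y-root ⟩
          B + y * d             ≡⟨ shift B d ⟩
          B + x * d + t * d     ≈⟨ +-cong-≈ x-root ≈-refl ⟨
          A + x * c + t * d     ≡⟨ +-comm _ (t * d) ⟩
          t * d + (A + x * c)   ∎)
          where open ≈-Reasoning
        t≡0 : t ≡ 0
        t≡0 = *-cancelˡ-≈ (≤-<-trans (m∸n≤m y x) y<p) c≉d tc≈td

    affine-root-unique : ∀ {A B c d x y} → ¬ (c ≈ d) → x < p → y < p →
      A + x * c ≈ B + x * d → A + y * c ≈ B + y * d → x ≡ y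
    affine-root-unique c≉d x<p y<p x-root y-root with ≤-total _ _
    ... | inj₁ x≤y = affine-root-unique-≤ c≉d x≤y y<p x-root y-root
    ... | inj₂ y≤x = sym (affine-root-unique-≤ c≉d y≤x x<p y-root x-root)

-- Polynomials linear in each row

module RowMultilinear (p : ℕ) .{{_ : NonZero p}} where

  open Congruence p

  rows : (n : ℕ) → List (Vec (Fin p) n)
  rows n = allVecs n (allFin p)

  length-rows : (n : ℕ) → length (rows n) ≡ p ^ n
  length-rows n = trans (length-allVecs n (allFin p)) (cong (_^ n) (length-allFin p))

  monomial : {n k : ℕ} → Vec (Vec (Fin p) n) k → Vec (Fin n) k → ℕ
  monomial {k = k} E τ = product (map (λ i → toℕ (lookup (lookup E i) (lookup τ i))) (allFin k))

  monomial-∷ : {n k : ℕ} (r : Vec (Fin p) n) (E : Vec (Vec (Fin p) n) k) (j : Fin n) (τ : Vec (Fin n) k) →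
               monomial (r ∷ E) (j ∷ τ) ≡ toℕ (lookup r j) * monomial E τ
  monomial-∷ {k = k} r E j τ =
    cong product (map-allFin-suc k (λ i → toℕ (lookup (lookup (r ∷ E) i) (lookup (j ∷ τ) i))))

  evalRows : {n k : ℕ} → (Vec (Fin n) k → ℕ) → Vec (Vec (Fin p) n) k → ℕ
  evalRows {n} {k} F E = ∑ (allVecs k (allFin n)) (λ τ → F τ * monomial E τ)

  linear : {n : ℕ} → Vec (Fin p) n → (Fin n → ℕ) → ℕ
  linear {n} r c = ∑ (allFin n) (λ j → toℕ (lookup r j) * c j)

  linear-∷ : {m : ℕ} (x : Fin p) (r : Vec (Fin p) m) (c : Fin (suc m) → ℕ) →
             linear (x ∷ r) c ≡ toℕ x * c zero + linear r (c ∘ suc)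
  linear-∷ {m} x r c = cong sum (map-allFin-suc m _)

  evalRows-[] : {n : ℕ} (F : Vec (Fin n) 0 → ℕ) → evalRows F [] ≡ F []
  evalRows-[] F = trans (+-identityʳ _) (*-identityʳ (F []))

  evalRows-∷ : {n k : ℕ} (F : Vec (Fin n) (suc k) → ℕ) (r : Vec (Fin p) n) (E : Vec (Vec (Fin p) n) k) →
               evalRows F (r ∷ E) ≡ linear r (λ j → evalRows (λ τ → F (j ∷ τ)) E)
  evalRows-∷ {n} {k} F r E = begin
    evalRows F (r ∷ E)
      ≡⟨ ∑-allVecs-suc k (allFin n) _ ⟩
    ∑ (allFin n) (λ j → ∑ T (λ τ → F (j ∷ τ) * monomial (r ∷ E) (j ∷ τ)))
      ≡⟨ ∑-cong (allFin n) (λ {j} _ → ∑-cong T (λ {τ} _ → pull-out j τ)) ⟩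
    ∑ (allFin n) (λ j → ∑ T (λ τ → toℕ (lookup r j) * (F (j ∷ τ) * monomial E τ)))
      ≡⟨ ∑-cong (allFin n) (λ {j} _ → *-distribˡ-∑ (toℕ (lookup r j)) T _) ⟨
    linear r (λ j → evalRows (λ τ → F (j ∷ τ)) E) ∎
    where
    open ≡-Reasoning
    T = allVecs k (allFin n)
    pull-out : ∀ j τ → F (j ∷ τ) * monomial (r ∷ E) (j ∷ τ)
                     ≡ toℕ (lookup r j) * (F (j ∷ τ) * monomial E τ)
    pull-out j τ = trans (cong (F (j ∷ τ) *_) (monomial-∷ r E j τ))
                         (*-left-comm (F (j ∷ τ)) (toℕ (lookup r j)) (monomial E τ))

  count-rows-suc : ∀ {m} (A B : ℕ) (c d : Fin (suc m) → ℕ) →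
    count (λ r → A + linear r c ≈? B + linear r d) (rows (suc m))
      ≡ ∑ (allFin p) (λ x → count (λ r → (A + toℕ x * c zero) + linear r (c ∘ suc)
                                      ≈? (B + toℕ x * d zero) + linear r (d ∘ suc)) (rows m))
  count-rows-suc {m} A B c d = trans (∑-allVecs-suc m (allFin p) _) (∑-cong (allFin p) (λ {x} _ →
    ∑-cong (rows m) (λ {r} _ → cong₂ (λ u v → 𝟙 (u ≈? v)) (split A x r c) (split B x r d))))
    where
    split : ∀ A x r (c : Fin (suc m) → ℕ) →
            A + linear (x ∷ r) c ≡ (A + toℕ x * c zero) + linear r (c ∘ suc)
    split A x r c = trans (cong (A +_) (linear-∷ x r c)) (sym (+-assoc A _ _))

  module _ (p-prime : Prime p) where

    affine-roots*p≤ : ∀ m (A B : ℕ) (c d : Fin m → ℕ) (j : Fin m) → ¬ (c j ≈ d j) →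
      count (λ r → A + linear r c ≈? B + linear r d) (rows m) * p ≤ p ^ m
    affine-roots*p≤ (suc m) A B c d zero c≉d = begin
      count (λ r → A + linear r c ≈? B + linear r d) (rows (suc m)) * p
        ≡⟨ cong (_* p) (trans (count-rows-suc A B c d) (∑-comm (allFin p) (rows m) _)) ⟩
      ∑ (rows m) (λ r → count (root r) (allFin p)) * p
        ≤⟨ *-monoˡ-≤ p (∑-mono-≤ (rows m) (λ {r} _ → at-most-one-root r)) ⟩
      ∑ (rows m) (λ _ → 1) * p
        ≡⟨ cong (_* p) (trans (sym (length≡∑1 (rows m))) (length-rows m)) ⟩
      p ^ m * p
        ≡⟨ *-comm (p ^ m) p ⟩
      p ^ suc m ∎
      where
      open ≤-Reasoning
      root = λ r x → (A + toℕ x * c zero) + linear r (c ∘ suc)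
                  ≈? (B + toℕ x * d zero) + linear r (d ∘ suc)
      at-most-one-root : ∀ r → count (root r) (allFin p) ≤ 1
      at-most-one-root r = count≤1 (root r) (allFin p) (Unique.allFin⁺ p) λ {x} {y} x-root y-root →
        Fin.toℕ-injective (affine-root-unique p-prime c≉d (Fin.toℕ<n x) (Fin.toℕ<n y)
                                              (reorder (toℕ x) x-root) (reorder (toℕ y) y-root))
        where
        L = linear r (c ∘ suc)
        L′ = linear r (d ∘ suc)
        reorder : ∀ t → (A + t * c zero) + L ≈ (B + t * d zero) + L′ →
                        (A + L) + t * c zero ≈ (B + L′) + t * d zero
        reorder _ e = ≈-trans (≈-reflexive (+-right-comm A _ _))
                              (≈-trans e (≈-reflexive (+-right-comm B _ _)))
    affine-roots*p≤ (suc m) A B c d (suc j) c≉d = begin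
      count (λ r → A + linear r c ≈? B + linear r d) (rows (suc m)) * p
        ≡⟨ cong (_* p) (count-rows-suc A B c d) ⟩
      ∑ (allFin p) (λ x → count (λ r → _ ≈? _) (rows m)) * p
        ≡⟨ *-distribʳ-∑ p (allFin p) _ ⟩
      ∑ (allFin p) (λ x → count (λ r → _ ≈? _) (rows m) * p)
        ≤⟨ ∑-mono-≤ (allFin p) (λ _ → affine-roots*p≤ m _ _ (c ∘ suc) (d ∘ suc) j c≉d) ⟩
      ∑ (allFin p) (λ _ → p ^ m)
        ≡⟨ ∑-const (allFin p) (p ^ m) ⟩
      length (allFin p) * p ^ m
        ≡⟨ cong (_* p ^ m) (length-allFin p) ⟩
      p ^ suc m ∎
      where open ≤-Reasoning

    schwartz-zippel : ∀ {n} k (F G : Vec (Fin n) k → ℕ) (τ : Vec (Fin n) k) → ¬ (F τ ≈ G τ) →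
      count (λ E → evalRows F E ≈? evalRows G E) (allVecs k (rows n)) * p ≤ k * (p ^ n) ^ k
    schwartz-zippel zero F G [] Fτ≉Gτ with evalRows F [] ≈? evalRows G []
    ... | yes e = ⊥-elim (Fτ≉Gτ (subst₂ _≈_ (evalRows-[] F) (evalRows-[] G) e))
    ... | no  _ = z≤n
    schwartz-zippel {n} (suc k) F G (j ∷ τ) Fτ≉Gτ = begin
      count (λ E → evalRows F E ≈? evalRows G E) (allVecs (suc k) V) * p
        ≡⟨ cong (_* p) split-first-row ⟩
      ∑ L W * p
        ≡⟨ *-distribʳ-∑ p L W ⟩
      ∑ L (λ E → W E * p)
        ≤⟨ ∑-mono-≤ L (λ {E} _ → per-tail E) ⟩
      ∑ L (λ E → Q + 𝟙 (u E j ≈? v E j) * (Q * p))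
        ≡⟨ ∑-distrib-+ L _ _ ⟩
      ∑ L (λ _ → Q) + ∑ L (λ E → 𝟙 (u E j ≈? v E j) * (Q * p))
        ≡⟨ cong₂ _+_ (∑-const L Q) (sym (*-distribʳ-∑ (Q * p) L _)) ⟩
      length L * Q + Z * (Q * p)
        ≡⟨ cong₂ (λ l z → l * Q + z) length-L (*-left-comm Z Q p) ⟩
      Q ^ k * Q + Q * (Z * p)
        ≤⟨ +-monoʳ-≤ (Q ^ k * Q) (*-monoʳ-≤ Q (schwartz-zippel k (F ∘ (j ∷_)) (G ∘ (j ∷_)) τ Fτ≉Gτ)) ⟩
      Q ^ k * Q + Q * (k * Q ^ k)
        ≡⟨ regroup (Q ^ k) Q k ⟩
      suc k * Q ^ suc k ∎
      where
      open ≤-Reasoning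
      V = rows n
      L = allVecs k V
      Q = p ^ n
      u v : Vec (Vec (Fin p) n) k → Fin n → ℕ
      u E i = evalRows (λ σ → F (i ∷ σ)) E
      v E i = evalRows (λ σ → G (i ∷ σ)) E
      W : Vec (Vec (Fin p) n) k → ℕ
      W E = count (λ r → linear r (u E) ≈? linear r (v E)) V
      Z = count (λ E → u E j ≈? v E j) L
      length-L : length L ≡ Q ^ k
      length-L = trans (length-allVecs k V) (cong (_^ k) (length-rows n))
      regroup : ∀ q Q k → q * Q + Q * (k * q) ≡ suc k * (Q * q)
      regroup = solve-∀
      split-first-row : count (λ E → evalRows F E ≈? evalRows G E) (allVecs (suc k) V) ≡ ∑ L W
      split-first-row = trans (∑-allVecs-suc k V _) (trans (∑-cong V (λ {r} _ → ∑-cong L (λ {E} _ →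
        cong₂ (λ a b → 𝟙 (a ≈? b)) (evalRows-∷ F r E) (evalRows-∷ G r E)))) (∑-comm V L _))
      per-tail : ∀ E → W E * p ≤ Q + 𝟙 (u E j ≈? v E j) * (Q * p)
      per-tail E with u E j ≈? v E j
      ... | no  uj≉vj = ≤-trans (affine-roots*p≤ n 0 0 (u E) (v E) j uj≉vj) (m≤m+n Q 0)
      ... | yes _     = begin
        W E * p                  ≤⟨ *-monoˡ-≤ p (count≤length _ V) ⟩
        length V * p             ≡⟨ cong (_* p) (length-rows n) ⟩
        Q * p                    ≤⟨ m≤n+m (Q * p) Q ⟩
        Q + Q * p                ≡⟨ cong (Q +_) (*-identityˡ (Q * p)) ⟨
        Q + 1 * (Q * p)          ∎

-- Permutations as vectors

lookup-ext : {A : Set} {k : ℕ} (u v : Vec A k) → (∀ i → lookup u i ≡ lookup v i) → u ≡ v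
lookup-ext u v eq =
  trans (sym (Vec.tabulate∘lookup u)) (trans (Vec.tabulate-cong eq) (Vec.tabulate∘lookup v))

injective⇒¬∀≢ : ∀ {m} (f : Fin m → Fin m) → (∀ {i j} → f i ≡ f j → i ≡ j) →
                ∀ y → ¬ (∀ x → ¬ f x ≡ y)
injective⇒¬∀≢ {suc m} f inj y miss = Fin.<⇒notInjective (n<1+n m) punchOut-y-injective
  where
  f′ : Fin (suc m) → Fin m
  f′ x = punchOut {i = y} (miss x ∘ sym)
  punchOut-y-injective : ∀ {i j} → f′ i ≡ f′ j → i ≡ j
  punchOut-y-injective {i} {j} = inj ∘ Fin.punchOut-injective {i = y} (miss i ∘ sym) (miss j ∘ sym)

module _ {n : ℕ} where

  infixr 9 _⊙_

  _⊙_ : Vec (Fin n) n → Vec (Fin n) n → Vec (Fin n) n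
  π ⊙ σ = tabulate (λ i → lookup π (lookup σ i))

  lookup-⊙ : (π σ : Vec (Fin n) n) (i : Fin n) → lookup (π ⊙ σ) i ≡ lookup π (lookup σ i)
  lookup-⊙ π σ = Vec.lookup∘tabulate _

  ⊙-isPerm : (π σ : Vec (Fin n) n) → IsPerm π → IsPerm σ → IsPerm (π ⊙ σ)
  ⊙-isPerm π σ π-inj σ-inj i j eq =
    σ-inj i j (π-inj _ _ (trans (sym (lookup-⊙ π σ i)) (trans eq (lookup-⊙ π σ j))))

  ⊙-cancelˡ : (π : Vec (Fin n) n) → IsPerm π → ∀ {σ σ′} → π ⊙ σ ≡ π ⊙ σ′ → σ ≡ σ′
  ⊙-cancelˡ π π-inj {σ} {σ′} eq = lookup-ext σ σ′ (λ i →
    π-inj _ _ (trans (sym (lookup-⊙ π σ i)) (trans (cong (λ v → lookup v i) eq) (lookup-⊙ π σ′ i))))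

  inverse : Vec (Fin n) n → Fin n → Fin n
  inverse π y with Fin.any? (λ x → lookup π x Fin.≟ y)
  ... | yes (x , _) = x
  ... | no  _       = y   -- junk value: a permutation misses no y

  module _ (π : Vec (Fin n) n) (π-inj : IsPerm π) where

    lookup-inverse : ∀ y → lookup π (inverse π y) ≡ y
    lookup-inverse y with Fin.any? (λ x → lookup π x Fin.≟ y)
    ... | yes (_ , πx≡y) = πx≡y
    ... | no  miss       =
      ⊥-elim (injective⇒¬∀≢ (lookup π) (π-inj _ _) y (λ x πx≡y → miss (x , πx≡y)))

    inverse-lookup : ∀ x → inverse π (lookup π x) ≡ x
    inverse-lookup x = π-inj _ _ (lookup-inverse (lookup π x))

    product-permute : (f : Fin n → ℕ) →
                      product (map (λ i → f (lookup π i)) (allFin n)) ≡ product (map f (allFin n))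
    product-permute f = trans (cong product (map-∘ (allFin n))) (product-↭ (↭.map⁺ f π[allFin]↭allFin))
      where
      ∈-π[allFin] : ∀ y → y ∈ map (lookup π) (allFin n)
      ∈-π[allFin] y =
        subst (_∈ map (lookup π) (allFin n)) (lookup-inverse y) (∈-map⁺ (lookup π) (∈-allFin _))
      π[allFin]↭allFin = ∼bag⇒↭ (unique∧set⇒bag
        (Unique.map⁺ (π-inj _ _) (Unique.allFin⁺ n)) (Unique.allFin⁺ n)
        (λ {y} → mk⇔ (λ _ → ∈-allFin y) (λ _ → ∈-π[allFin] y)))

  conjugate : Vec (Fin n) n → Vec (Fin n) n → Vec (Fin n) n
  conjugate π σ = tabulate (λ r → lookup π (lookup σ (inverse π r)))

  lookup-conjugate : (π : Vec (Fin n) n) → IsPerm π → (σ : Vec (Fin n) n) (i : Fin n) →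
                     lookup (conjugate π σ) (lookup π i) ≡ lookup π (lookup σ i)
  lookup-conjugate π π-inj σ i = trans (Vec.lookup∘tabulate _ (lookup π i))
                                       (cong (lookup π ∘ lookup σ) (inverse-lookup π π-inj i))

-- Generalized permanents

Endo : ℕ → Set
Endo n = Vec (Fin n) n

module _ {n : ℕ} where

  endos : List (Endo n)
  endos = allVecs n (allFin n)

  endos-unique : Unique endos
  endos-unique = allVecs-unique n (allFin n) (Unique.allFin⁺ n)

  ∈-endos : (σ : Endo n) → σ ∈ endos
  ∈-endos σ = ∈-allVecs n (allFin n) σ (λ i → ∈-allFin (lookup σ i))

  Sn-unique : Unique (Sn n)
  Sn-unique = Unique.filter⁺ isPerm? endos-unique

  ∈-Sn : {σ : Endo n} → IsPerm σ → σ ∈ Sn n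
  ∈-Sn {σ} σ-perm = ∈-filter⁺ isPerm? (∈-endos σ) σ-perm

  Sn-isPerm : {σ : Endo n} → σ ∈ Sn n → IsPerm σ
  Sn-isPerm σ∈Sn = proj₂ (∈-filter⁻ isPerm? {xs = endos} σ∈Sn)

  _≟ᵥ_ : DecidableEquality (Endo n)
  _≟ᵥ_ = Vec.≡-dec Fin._≟_

  indic≡𝟙 : (σ : Endo n) (i j : Fin n) → indic σ i j ≡ 𝟙 (lookup σ i Fin.≟ j)
  indic≡𝟙 σ i j with lookup σ i Fin.≟ j
  ... | yes _ = refl
  ... | no  _ = refl

  indic≡1⇒lookup≡ : (σ : Endo n) (i j : Fin n) → indic σ i j ≡ 1 → lookup σ i ≡ j
  indic≡1⇒lookup≡ σ i j indic≡1 with lookup σ i Fin.≟ j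
  ... | yes σi≡j = σi≡j
  ... | no  _    = ⊥-elim (0≢1+n indic≡1)

  infix 4 _≐_

  _≐_ : Exponent n → Exponent n → Set
  m ≐ m′ = ∀ i j → m i j ≡ m′ i j

  indic-injective : {σ τ : Endo n} → indic σ ≐ indic τ → σ ≡ τ
  indic-injective {σ} {τ} σ≐τ = lookup-ext σ τ (λ i →
    sym (indic≡1⇒lookup≡ τ i _ (trans (sym (σ≐τ i (lookup σ i))) (indic-self i))))
    where
    indic-self : ∀ i → indic σ i (lookup σ i) ≡ 1
    indic-self i = trans (indic≡𝟙 σ i _) (when-yes refl (lookup σ i Fin.≟ lookup σ i) 1)

  rename : Endo n → Exponent n → Exponent n
  rename π m i j = m (lookup π i) (lookup π j)

  module _ (π : Endo n) (π-perm : IsPerm π) where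

    indic-conjugate : (σ : Endo n) (i j : Fin n) →
                      indic (conjugate π σ) (lookup π i) (lookup π j) ≡ indic σ i j
    indic-conjugate σ i j = begin
      indic (conjugate π σ) (lookup π i) (lookup π j)            ≡⟨ indic≡𝟙 (conjugate π σ) _ _ ⟩
      𝟙 (lookup (conjugate π σ) (lookup π i) Fin.≟ lookup π j)
        ≡⟨ when-cong (λ e → π-perm _ _ (trans (sym (lookup-conjugate π π-perm σ i)) e))
                     (λ e → trans (lookup-conjugate π π-perm σ i) (cong (lookup π) e)) _ _ 1 ⟩
      𝟙 (lookup σ i Fin.≟ j)                                      ≡⟨ indic≡𝟙 σ i j ⟨
      indic σ i j                                                  ∎
      where open ≡-Reasoning

    rename-≐-indic⁻ : ∀ {m σ} → m ≐ indic (conjugate π σ) → rename π m ≐ indic σ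
    rename-≐-indic⁻ {σ = σ} m≐ i j = trans (m≐ _ _) (indic-conjugate σ i j)

    rename-≐-indic⁺ : ∀ {m σ} → rename π m ≐ indic σ → m ≐ indic (conjugate π σ)
    rename-≐-indic⁺ {m} {σ} rename≐ r c =
      subst₂ (λ r′ c′ → m r′ c′ ≡ indic (conjugate π σ) r′ c′)
             (lookup-inverse π π-perm r) (lookup-inverse π π-perm c)
             (trans (rename≐ _ _) (sym (indic-conjugate σ _ _)))

module Permanent {n p : ℕ} .{{_ : NonZero p}} (a : Coeffs n p) where

  open Congruence p
  open RowMultilinear p

  coeff : Endo n → ℕ
  coeff σ = toℕ (a σ)

  -- The coefficient of ∏ᵢ e_(i,τ(i)) in Σ_σ a_σ ∏ᵢ e_(i,(g σ)(i)).
  fibre : (Endo n → Endo n) → Endo n → ℕ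
  fibre g τ = ∑ (Sn n) (λ σ → when (g σ ≟ᵥ τ) (coeff σ))

  ∑-coeff*monomial : (g : Endo n → Endo n) (E : Mat n p) →
                     ∑ (Sn n) (λ σ → coeff σ * monomial E (g σ)) ≡ evalRows (fibre g) E
  ∑-coeff*monomial g E =
    ∑-fibres _≟ᵥ_ g (Sn n) endos endos-unique (λ σ → ∈-endos (g σ)) coeff (monomial E)

  monomial-act : (π : Endo n) → IsPerm π → (E : Mat n p) (σ : Endo n) →
                 monomial (actMat π E) σ ≡ monomial E (conjugate π σ)
  monomial-act π π-perm E σ = begin
    monomial (actMat π E) σ
      ≡⟨ cong product (map-cong (λ i → cong toℕ (entry-act i (lookup σ i))) (allFin n)) ⟩
    product (map (λ i → entry E (lookup π i) (lookup π (lookup σ i))) (allFin n))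
      ≡⟨ cong product (map-cong (λ i → cong (entry E (lookup π i)) (lookup-conjugate π π-perm σ i))
                                (allFin n)) ⟨
    product (map (λ i → entry E (lookup π i) (lookup (conjugate π σ) (lookup π i))) (allFin n))
      ≡⟨ product-permute π π-perm (λ r → entry E r (lookup (conjugate π σ) r)) ⟩
    monomial E (conjugate π σ) ∎
    where
    open ≡-Reasoning
    entry-act : ∀ i j → lookup (lookup (actMat π E) i) j ≡ lookup (lookup E (lookup π i)) (lookup π j)
    entry-act i j = trans (cong (λ row → lookup row j) (Vec.lookup∘tabulate _ i)) (Vec.lookup∘tabulate _ j)

  evalH≡ : (E : Mat n p) → evalH p a E ≡ evalRows (fibre id) E % p
  evalH≡ E = trans (modp≡% p _) (cong (_% p) (∑-coeff*monomial id E))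

  evalH-act≡ : (π : Endo n) → IsPerm π → (E : Mat n p) →
               evalH p a (actMat π E) ≡ evalRows (fibre (conjugate π)) E % p
  evalH-act≡ π π-perm E = trans (modp≡% p _) (cong (_% p) (begin
    ∑ (Sn n) (λ σ → coeff σ * monomial (actMat π E) σ)
      ≡⟨ ∑-cong (Sn n) (λ {σ} _ → cong (coeff σ *_) (monomial-act π π-perm E σ)) ⟩
    ∑ (Sn n) (λ σ → coeff σ * monomial E (conjugate π σ))
      ≡⟨ ∑-coeff*monomial (conjugate π) E ⟩
    evalRows (fibre (conjugate π)) E ∎))
    where open ≡-Reasoning

  toPoly≡∑ : (m : Exponent n) → toPoly a m ≡ ∑ (Sn n) (λ σ → when (isMonoOf? σ m) (coeff σ))
  toPoly≡∑ m = summands-agree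
    where
    -- The summand of toPoly is bound in a where block of Defs and cannot be named,
    -- so the statement of summand≡when is left to unification with its use below.
    summand≡when : ∀ σ → _
    summands-agree : toPoly a m ≡ ∑ (Sn n) (λ σ → when (isMonoOf? σ m) (coeff σ))
    summands-agree = cong sum (map-cong summand≡when (Sn n))
    summand≡when σ with isMonoOf? σ m
    ... | yes _ = refl
    ... | no  _ = refl

  toPoly-cong : {m m′ : Exponent n} → m ≐ m′ → toPoly a m ≡ toPoly a m′
  toPoly-cong {m} {m′} m≐m′ = trans (toPoly≡∑ m) (trans (∑-cong (Sn n) (λ {σ} _ →
    when-cong (λ m≐σ i j → trans (sym (m≐m′ i j)) (m≐σ i j))
              (λ m′≐σ i j → trans (m≐m′ i j) (m′≐σ i j))
              (isMonoOf? σ m) (isMonoOf? σ m′) (coeff σ))) (sym (toPoly≡∑ m′)))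

  toPoly-fibre : (m : Exponent n) (g : Endo n → Endo n) (τ : Endo n) →
                 (∀ σ → m ≐ indic σ → g σ ≡ τ) → (∀ σ → g σ ≡ τ → m ≐ indic σ) →
                 toPoly a m ≡ fibre g τ
  toPoly-fibre m g τ to from = trans (toPoly≡∑ m)
    (∑-cong (Sn n) (λ {σ} _ → when-cong (to σ) (from σ) (isMonoOf? σ m) (g σ ≟ᵥ τ) (coeff σ)))

  toPoly-vanishes : (m : Exponent n) → (∀ σ → ¬ m ≐ indic σ) → toPoly a m ≡ 0
  toPoly-vanishes m no-monomial = trans (toPoly≡∑ m) (trans
    (∑-cong (Sn n) (λ {σ} _ → when-no (no-monomial σ) (isMonoOf? σ m) (coeff σ))) (∑0≡0 (Sn n)))

  module _ {m : Exponent n} {τ : Endo n} (m≐τ : m ≐ indic τ) where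

    toPoly-at-indic : toPoly a m ≡ fibre id τ
    toPoly-at-indic = toPoly-fibre m id τ
      (λ σ m≐σ → indic-injective (λ i j → trans (sym (m≐σ i j)) (m≐τ i j)))
      (λ σ σ≡τ → subst (λ t → m ≐ indic t) (sym σ≡τ) m≐τ)

    toPoly-rename-at-indic : (π : Endo n) → IsPerm π → toPoly a (rename π m) ≡ fibre (conjugate π) τ
    toPoly-rename-at-indic π π-perm = toPoly-fibre (rename π m) (conjugate π) τ
      (λ σ rename≐σ → indic-injective (λ i j →
        trans (sym (rename-≐-indic⁺ π π-perm rename≐σ i j)) (m≐τ i j)))
      (λ σ πσπ⁻¹≡τ → rename-≐-indic⁻ π π-perm (subst (λ t → m ≐ indic t) (sym πσπ⁻¹≡τ) m≐τ))

  Invariant : Endo n → Set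
  Invariant π = All (λ τ → fibre id τ ≈ fibre (conjugate π) τ) endos

  invariant? : Decidable Invariant
  invariant? π = All.all? (λ τ → fibre id τ ≈? fibre (conjugate π) τ) endos

  InPi⇒Invariant : (π : Endo n) → IsPerm π → InPi p a π → Invariant π
  InPi⇒Invariant π π-perm π∈Π = All.tabulate (λ {τ} _ → mod (begin
    fibre id τ % p                            ≡⟨ cong (_% p) (toPoly-at-indic (λ _ _ → refl)) ⟨
    toPoly a (indic τ) % p                    ≡⟨ modp≡% p _ ⟨
    modp p (toPoly a (indic τ))               ≡⟨ π∈Π (indic τ) ⟨
    modp p (toPoly a (rename π (indic τ)))    ≡⟨ modp≡% p _ ⟩
    toPoly a (rename π (indic τ)) % p         ≡⟨ cong (_% p) (toPoly-rename-at-indic (λ _ _ → refl) π π-perm) ⟩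
    fibre (conjugate π) τ % p                 ∎))
    where open ≡-Reasoning

  Invariant⇒InPi : (π : Endo n) → IsPerm π → Invariant π → InPi p a π
  Invariant⇒InPi π π-perm invariant m with any? (λ τ → isMonoOf? τ m) endos
  ... | yes m-monomial with satisfied m-monomial
  ...   | τ , m≐τ = begin
    modp p (toPoly a (rename π m))    ≡⟨ modp≡% p _ ⟩
    toPoly a (rename π m) % p         ≡⟨ cong (_% p) (toPoly-rename-at-indic m≐τ π π-perm) ⟩
    fibre (conjugate π) τ % p         ≡⟨ %≡% (All.lookup invariant (∈-endos τ)) ⟨
    fibre id τ % p                    ≡⟨ cong (_% p) (toPoly-at-indic m≐τ) ⟨
    toPoly a m % p                    ≡⟨ modp≡% p _ ⟨
    modp p (toPoly a m)               ∎
    where open ≡-Reasoning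
  Invariant⇒InPi π π-perm invariant m | no ¬m-monomial = cong (modp p) (trans
    (toPoly-vanishes (rename π m) (λ σ → not-monomial (conjugate π σ) ∘ rename-≐-indic⁺ π π-perm))
    (sym (toPoly-vanishes m not-monomial)))
    where
    not-monomial : ∀ σ → ¬ m ≐ indic σ
    not-monomial σ m≐σ = ¬m-monomial (Any.map (λ { refl → m≐σ }) (∈-endos σ))

  InPi-cancelʳ : (π σ : Endo n) → InPi p a σ → InPi p a (π ⊙ σ) → InPi p a π
  InPi-cancelʳ π σ σ∈Π πσ∈Π m = begin
    modp p (toPoly a (rename π m))               ≡⟨ σ∈Π (rename π m) ⟨
    modp p (toPoly a (rename σ (rename π m)))    ≡⟨ cong (modp p) (toPoly-cong rename-⊙) ⟩
    modp p (toPoly a (rename (π ⊙ σ) m))         ≡⟨ πσ∈Π m ⟩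
    modp p (toPoly a m)                          ∎
    where
    open ≡-Reasoning
    rename-⊙ : rename σ (rename π m) ≐ rename (π ⊙ σ) m
    rename-⊙ i j = sym (cong₂ m (lookup-⊙ π σ i) (lookup-⊙ π σ j))

  Invariant-cancelʳ : (π σ : Endo n) → IsPerm π → IsPerm σ →
                      Invariant σ → Invariant (π ⊙ σ) → Invariant π
  Invariant-cancelʳ π σ π-perm σ-perm σ-inv πσ-inv = InPi⇒Invariant π π-perm (InPi-cancelʳ π σ
    (Invariant⇒InPi σ σ-perm σ-inv) (Invariant⇒InPi (π ⊙ σ) (⊙-isPerm π σ π-perm σ-perm) πσ-inv))

  accepted : Endo n → ℕ
  accepted π = count (λ E → accepts? a (E , π)) (allMats n p)

  acceptCount≡∑accepted : acceptCount n p a ≡ ∑ (Sn n) accepted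
  acceptCount≡∑accepted = trans (length-filter≡count (accepts? a) (cartesianProduct (allMats n p) (Sn n)))
    (trans (∑-cartesianProductWith _,_ (allMats n p) (Sn n) _) (∑-comm (allMats n p) (Sn n) _))

  length-allMats : length (allMats n p) ≡ (p ^ n) ^ n
  length-allMats = trans (length-allVecs n (rows n)) (cong (_^ n) (length-rows n))

  module _ (π : Endo n) (π-perm : IsPerm π) where

    Agree : Mat n p → Set
    Agree E = evalRows (fibre id) E ≈ evalRows (fibre (conjugate π)) E

    accepts⇒Agree : ∀ E → evalH p a E ≡ evalH p a (actMat π E) → Agree E
    accepts⇒Agree E accepts = mod (trans (sym (evalH≡ E)) (trans accepts (evalH-act≡ π π-perm E)))

    Agree⇒accepts : ∀ E → Agree E → evalH p a E ≡ evalH p a (actMat π E)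
    Agree⇒accepts E agree = trans (evalH≡ E) (trans (%≡% agree) (sym (evalH-act≡ π π-perm E)))

    Invariant⇒accepted≡ : Invariant π → accepted π ≡ length (allMats n p)
    Invariant⇒accepted≡ invariant = trans
      (∑-cong (allMats n p) (λ {E} _ → when-yes (Agree⇒accepts E (agree E)) (accepts? a (E , π)) 1))
      (sym (length≡∑1 (allMats n p)))
      where
      agree : ∀ E → Agree E
      agree E = ∑-cong-≈ endos (λ τ → *-cong-≈ (All.lookup invariant (∈-endos τ)) ≈-refl)

    ¬Invariant⇒accepted*p≤ : Prime p → ¬ Invariant π → accepted π * p ≤ n * length (allMats n p)
    ¬Invariant⇒accepted*p≤ p-prime ¬invariant
      with satisfied (¬All⇒Any¬ (λ τ → fibre id τ ≈? fibre (conjugate π) τ) endos ¬invariant)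
    ... | τ , fibres≉ = begin
      accepted π * p
        ≡⟨ cong (_* p) (∑-cong (allMats n p) (λ {E} _ →
             when-cong (accepts⇒Agree E) (Agree⇒accepts E) (accepts? a (E , π)) (_ ≈? _) 1)) ⟩
      count (λ E → evalRows (fibre id) E ≈? evalRows (fibre (conjugate π)) E) (allMats n p) * p
        ≤⟨ schwartz-zippel p-prime n (fibre id) (fibre (conjugate π)) τ fibres≉ ⟩
      n * (p ^ n) ^ n
        ≡⟨ cong (n *_) length-allMats ⟨
      n * length (allMats n p) ∎
      where open ≤-Reasoning

-- Averaging over S_n

module _ {n : ℕ} {Q : Endo n → Set} (Q? : Decidable Q)
         (Q-cancelʳ : ∀ π σ → IsPerm π → IsPerm σ → Q σ → Q (π ⊙ σ) → Q π) where

  proper⇒2*count≤length : ¬ (∀ π → IsPerm π → Q π) → 2 * count Q? (Sn n) ≤ length (Sn n)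
  proper⇒2*count≤length proper with All.all? Q? (Sn n)
  ... | yes all-Q = ⊥-elim (proper (λ π π-perm → All.lookup all-Q (∈-Sn π-perm)))
  ... | no ¬all-Q with find (¬All⇒Any¬ Q? (Sn n) ¬all-Q)
  ...   | π , π∈Sn , ¬Qπ = begin
    2 * g     ≡⟨ cong (g +_) (+-identityʳ g) ⟩
    g + g     ≤⟨ +-monoʳ-≤ g g≤b ⟩
    g + b     ≡⟨ g+b≡length ⟩
    length (Sn n) ∎
    where
    open ≤-Reasoning
    ¬Q? = λ σ → ¬? (Q? σ)
    Q-part = filter Q? (Sn n)
    g = count Q? (Sn n)
    b = count ¬Q? (Sn n)
    π-perm = Sn-isPerm π∈Sn
    π⊙Q-part⊆¬Q-part : ∀ {τ} → τ ∈ map (π ⊙_) Q-part → τ ∈ filter ¬Q? (Sn n)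
    π⊙Q-part⊆¬Q-part τ∈ with ∈-map⁻ (π ⊙_) τ∈
    ... | σ , σ∈Q-part , refl with ∈-filter⁻ Q? {xs = Sn n} σ∈Q-part
    ...   | σ∈Sn , Qσ =
      ∈-filter⁺ ¬Q? (∈-Sn (⊙-isPerm π σ π-perm σ-perm)) (¬Qπ ∘ Q-cancelʳ π σ π-perm σ-perm Qσ)
      where σ-perm = Sn-isPerm σ∈Sn
    π⊙Q-part-unique : Unique (map (π ⊙_) Q-part)
    π⊙Q-part-unique = Unique.map⁺ (⊙-cancelˡ π π-perm) (Unique.filter⁺ Q? Sn-unique)
    g≤b : g ≤ b
    g≤b = subst₂ _≤_ (trans (length-map (π ⊙_) Q-part) (length-filter≡count Q? (Sn n)))
                     (length-filter≡count ¬Q? (Sn n))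
                     (Unique∧⊆⇒length≤ _≟ᵥ_ π⊙Q-part-unique π⊙Q-part⊆¬Q-part)
    g+b≡length : g + b ≡ length (Sn n)
    g+b≡length = trans (sym (∑-distrib-+ (Sn n) _ _))
      (trans (∑-cong (Sn n) (λ {σ} _ → 𝟙+𝟙¬≡1 (Q? σ))) (sym (length≡∑1 (Sn n))))

module _ {A : Set} {P : A → Set} (P? : Decidable P) (xs : List A) (f : A → ℕ) (N p k : ℕ) where

  averaging : (∀ {x} → x ∈ xs → P x → f x ≤ N) →
              (∀ {x} → x ∈ xs → ¬ P x → f x * p ≤ k * N) →
              2 * count P? xs ≤ length xs →
              2 * p * ∑ xs f ≤ (p + 2 * k) * (N * length xs)
  averaging f≤N f*p≤kN 2g≤L = begin
    2 * p * ∑ xs f                        ≡⟨ *-assoc 2 p (∑ xs f) ⟩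
    2 * (p * ∑ xs f)                      ≤⟨ *-monoʳ-≤ 2 p∑f≤ ⟩
    2 * (g * (p * N) + L * (k * N))       ≡⟨ regroup₁ g p N L k ⟩
    2 * g * (p * N) + 2 * (L * (k * N))   ≤⟨ +-monoˡ-≤ _ (*-monoˡ-≤ (p * N) 2g≤L) ⟩
    L * (p * N) + 2 * (L * (k * N))       ≡⟨ regroup₂ L p N k ⟩
    (p + 2 * k) * (N * L)                 ∎
    where
    open ≤-Reasoning
    g = count P? xs
    L = length xs
    regroup₁ : ∀ g p N L k → 2 * (g * (p * N) + L * (k * N)) ≡ 2 * g * (p * N) + 2 * (L * (k * N))
    regroup₁ = solve-∀
    regroup₂ : ∀ L p N k → L * (p * N) + 2 * (L * (k * N)) ≡ (p + 2 * k) * (N * L)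
    regroup₂ = solve-∀
    per-element : ∀ {x} → x ∈ xs → p * f x ≤ 𝟙 (P? x) * (p * N) + k * N
    per-element {x} x∈xs with P? x
    ... | yes Px = begin
      p * f x                 ≤⟨ *-monoʳ-≤ p (f≤N x∈xs Px) ⟩
      p * N                   ≡⟨ *-identityˡ (p * N) ⟨
      1 * (p * N)             ≤⟨ m≤m+n (1 * (p * N)) (k * N) ⟩
      1 * (p * N) + k * N     ∎
    ... | no ¬Px = ≤-trans (≤-reflexive (*-comm p (f x))) (f*p≤kN x∈xs ¬Px)
    p∑f≤ : p * ∑ xs f ≤ g * (p * N) + L * (k * N)
    p∑f≤ = begin
      p * ∑ xs f                                              ≡⟨ *-distribˡ-∑ p xs f ⟩
      ∑ xs (λ x → p * f x)                                    ≤⟨ ∑-mono-≤ xs per-element ⟩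
      ∑ xs (λ x → 𝟙 (P? x) * (p * N) + k * N)                 ≡⟨ ∑-distrib-+ xs _ _ ⟩
      ∑ xs (λ x → 𝟙 (P? x) * (p * N)) + ∑ xs (λ _ → k * N)
        ≡⟨ cong₂ _+_ (sym (*-distribʳ-∑ (p * N) xs (λ x → 𝟙 (P? x)))) (∑-const xs (k * N)) ⟩
      g * (p * N) + L * (k * N)                               ∎

lemma11 : (n p : ℕ) → Prime p → n < p → (a : Coeffs n p) →
    (InI n p a → acceptCount n p a ≡ sampleCount n p)
    × (¬ InI n p a → 2 * p * acceptCount n p a ≤ (p + 2 * n) * sampleCount n p)
lemma11 n p p-prime _ a = accepts-always , accepts-rarely
  where
  instance
    p≢0 : NonZero p
    p≢0 = prime⇒nonZero p-prime
  open Permanent a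
  N = length (allMats n p)

  accepts-always : InI n p a → acceptCount n p a ≡ sampleCount n p
  accepts-always H∈I = begin
    acceptCount n p a     ≡⟨ acceptCount≡∑accepted ⟩
    ∑ (Sn n) accepted     ≡⟨ ∑-cong (Sn n) (λ {π} π∈Sn → let π-perm = Sn-isPerm π∈Sn in
                               Invariant⇒accepted≡ π π-perm (InPi⇒Invariant π π-perm (H∈I π π-perm))) ⟩
    ∑ (Sn n) (λ _ → N)    ≡⟨ ∑-const (Sn n) N ⟩
    length (Sn n) * N     ≡⟨ *-comm (length (Sn n)) N ⟩
    sampleCount n p       ∎
    where open ≡-Reasoning

  accepts-rarely : ¬ InI n p a → 2 * p * acceptCount n p a ≤ (p + 2 * n) * sampleCount n p
  accepts-rarely H∉I = begin
    2 * p * acceptCount n p a       ≡⟨ cong (2 * p *_) acceptCount≡∑accepted ⟩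
    2 * p * ∑ (Sn n) accepted       ≤⟨ averaging invariant? (Sn n) accepted N p n
      (λ {π} π∈Sn → ≤-reflexive ∘ Invariant⇒accepted≡ π (Sn-isPerm π∈Sn))
      (λ {π} π∈Sn → ¬Invariant⇒accepted*p≤ π (Sn-isPerm π∈Sn) p-prime)
      (proper⇒2*count≤length invariant? Invariant-cancelʳ Π≢Sn) ⟩
    (p + 2 * n) * sampleCount n p   ∎
    where
    open ≤-Reasoning
    Π≢Sn : ¬ (∀ π → IsPerm π → Invariant π)
    Π≢Sn all-invariant = H∉I (λ π π-perm → Invariant⇒InPi π π-perm (all-invariant π π-perm))
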